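{- Let $\mathbb{P}$ be a poset and $\mu$ a cardinal. If $\mathbb{P}$ is strongly ${<}\,\mu$-directed closed, then the separative quotient of $\mathbb{P}$ is ${<}\,\mu$-directed closed.
   Context: For a poset $\mathbb{P}$, $X\subseteq\mathbb{P}$ is weakly directed if for all $p,q\in X$ there is $r\in X$ such that $r\Vdash p\in\Gamma_{\mathbb{P}}\wedge q\in\Gamma_{\mathbb{P}}$ (equivalently, every extension of $r$ is compatible with $p$ and with $q$). $\mathbb{P}$ is strongly ${<}\,\mu$-directed closed if every weakly directed $X\subseteq\mathbb{P}$ with $|X|<\mu$ has a lower bound in $\mathbb{P}$. The separative quotient of $\mathbb{P}$ is $\mathbb{P}/{\sim}$ where $p\sim q$ iff for all $z$ ($z\perp p\leftrightarrow z\perp q$), ordered by $[p]\preceq[q]$ iff every $r\leq p$ is compatible with $q$. A poset is ${<}\,\mu$-directed closed if every directed subset of size ${<}\,\mu$ has a lower bound. -}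

module Defs where

open import Level using (Level; _⊔_; suc)
open import Data.Product using (Σ; ∃; _×_; _,_)
open import Relation.Binary.Bundles using (Poset)
open import Relation.Nullary using (¬_)
open import Function.Bundles using (_⇔_)

-- A cardinal μ is represented by the class of index types of cardinality < μ:
--   Below : Set ι → Set s,  "Below I" means |I| < μ.
-- A subset X of size < μ of a set A is represented as a family x : I → A with Below I
-- (its range is X).

module _ {c ℓ₁ ℓ₂ : Level} (ℙ : Poset c ℓ₁ ℓ₂) where
  open Poset ℙ using (_≤_) renaming (Carrier to P)

  Compatible : P → P → Set (c ⊔ ℓ₂)
  Compatible p q = Σ P λ z → (z ≤ p) × (z ≤ q)

  _⊥_ : P → P → Set (c ⊔ ℓ₂)
  p ⊥ q = ¬ Compatible p q

  -- r ⊩ (p ∈ Γ ∧ q ∈ Γ): every extension of r is compatible with p and with q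
  Forces₂ : P → P → P → Set (c ⊔ ℓ₂)
  Forces₂ r p q = ∀ s → s ≤ r → Compatible s p × Compatible s q

  WeaklyDirected : {ι : Level} {I : Set ι} → (I → P) → Set (ι ⊔ c ⊔ ℓ₂)
  WeaklyDirected {I = I} x = ∀ i j → Σ I λ k → Forces₂ (x k) (x i) (x j)

  LowerBound : {ι : Level} {I : Set ι} → (I → P) → Set (ι ⊔ c ⊔ ℓ₂)
  LowerBound {I = I} x = Σ P λ p → ∀ i → p ≤ x i

  StronglyDirectedClosed : {ι s : Level} → (Below : Set ι → Set s) → Set (suc ι ⊔ s ⊔ c ⊔ ℓ₂)
  StronglyDirectedClosed {ι} Below =
    (I : Set ι) → Below I → (x : I → P) → WeaklyDirected x → LowerBound x

  -- Separative quotient ℙ/∼.  Its elements are ∼-classes [p]; we represent a class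
  -- by any representative p ∈ P.
  _≈ₛ_ : P → P → Set (c ⊔ ℓ₂)
  p ≈ₛ q = ∀ z → (z ⊥ p) ⇔ (z ⊥ q)

  _≼_ : P → P → Set (c ⊔ ℓ₂)
  p ≼ q = ∀ r → r ≤ p → Compatible r q

module _ {a r : Level} {A : Set a} (_⊑_ : A → A → Set r) where

  Directed : {ι : Level} {I : Set ι} → (I → A) → Set (ι ⊔ r)
  Directed {I = I} x = ∀ i j → Σ I λ k → (x k ⊑ x i) × (x k ⊑ x j)

  HasLowerBound : {ι : Level} {I : Set ι} → (I → A) → Set (ι ⊔ a ⊔ r)
  HasLowerBound {I = I} x = Σ A λ p → ∀ i → p ⊑ x i

  DirectedClosed : {ι s : Level} → (Below : Set ι → Set s) → Set (suc ι ⊔ s ⊔ a ⊔ r)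
  DirectedClosed {ι} Below =
    (I : Set ι) → Below I → (x : I → A) → Directed x → HasLowerBound x

-- A family directed for ≼ is weakly directed in ℙ, since r ≼ p says precisely that r forces
-- p into the generic filter.  Hence strong closure yields a lower bound in ℙ, and every
-- ≤-lower bound is also a ≼-lower bound.
module Submission where

open import Defs
open import Level using (Level)
open import Relation.Binary.Bundles using (Poset)
open import Data.Product using (_,_)

module _ {c ℓ₁ ℓ₂ : Level} (ℙ : Poset c ℓ₁ ℓ₂) where
  open Poset ℙ using (_≤_; refl; trans) renaming (Carrier to P)

  ≤⇒≼ : ∀ {p q} → p ≤ q → _≼_ ℙ p q
  ≤⇒≼ p≤q r r≤p = r , refl , trans r≤p p≤q

  ≼-forces₂ : ∀ {r p q} → _≼_ ℙ r p → _≼_ ℙ r q → Forces₂ ℙ r p q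
  ≼-forces₂ r≼p r≼q s s≤r = r≼p s s≤r , r≼q s s≤r

  directed⇒weaklyDirected : ∀ {ι} {I : Set ι} {x : I → P} →
    Directed (_≼_ ℙ) x → WeaklyDirected ℙ x
  directed⇒weaklyDirected dir i j with dir i j
  ... | k , k≼i , k≼j = k , ≼-forces₂ k≼i k≼j

  lowerBound⇒≼-lowerBound : ∀ {ι} {I : Set ι} {x : I → P} →
    LowerBound ℙ x → HasLowerBound (_≼_ ℙ) x
  lowerBound⇒≼-lowerBound (p , p≤x) = p , λ i → ≤⇒≼ (p≤x i)

mainTheorem11 : {c ℓ₁ ℓ₂ ι s : Level} (ℙ : Poset c ℓ₁ ℓ₂) (Below : Set ι → Set s) →
    StronglyDirectedClosed ℙ Below → DirectedClosed (_≼_ ℙ) Below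
mainTheorem11 ℙ Below closed I |I|<μ x dir =
  lowerBound⇒≼-lowerBound ℙ (closed I |I|<μ x (directed⇒weaklyDirected ℙ dir))
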